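{- Let $D$ be an oriented tree (an orientation of a finite tree). Then $\operatorname{Ext}(D)$ is both a minimum hull set and a minimum geodetic set of $D$. Consequently, the minimum hull set and the minimum geodetic set of $D$ are unique and $\operatorname{hn}(D) = \operatorname{gn}(D) = |\operatorname{Ext}(D)|$.
   Context: For an oriented graph $D$: a $(u,v)$-geodesic is a directed $(u,v)$-path with the minimum number of arcs; for $S \subseteq V(D)$ with $|S|\ge 2$, $I(S)$ is the set of vertices on some $(u,v)$-geodesic with $u,v \in S$ (endpoints included), and $I(S)=S$ if $|S|\le1$; $S$ is convex if $I(S)=S$; the hull $[S]$ is the smallest convex set containing $S$; $S$ is a hull set if $[S]=V(D)$ and a geodetic set if $I(S)=V(D)$; $\operatorname{hn}(D)$, $\operatorname{gn}(D)$ are the minimum sizes of a hull set and of a geodetic set. A vertex $v$ is extreme if $d^-(v)=0$ (transmitter), or $d^+(v)=0$ (receiver), or ($d^-(v)>0$, $d^+(v)>0$ and $(u,w)\in A(D)$ for all $u\in N^-(v)$, $w\in N^+(v)$) (transitive); $\operatorname{Ext}(D)$ is the set of extreme vertices. -}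

module Defs where

open import Data.Nat using (ℕ; zero; suc; _≤_)
open import Data.Bool using (Bool; true; false)
open import Data.Fin using (Fin)
open import Data.Fin.Subset using (Subset; _∈_; _⊆_; ∣_∣)
open import Data.List using (List; []; _∷_)
open import Data.List.Relation.Unary.Unique.Propositional using (Unique)
import Data.List.Membership.Propositional as LM
open import Data.Product using (Σ; _×_; ∃; ∃-syntax)
open import Data.Sum using (_⊎_)
open import Relation.Nullary using (¬_)
open import Relation.Binary.PropositionalEquality using (_≡_)
open import Function.Bundles using (_⇔_)

record OrientedGraph (n : ℕ) : Set where
  field
    A     : Fin n → Fin n → Bool
    irrefl : ∀ v → A v v ≡ false
    asym   : ∀ u v → A u v ≡ true → A v u ≡ false

module _ {n : ℕ} (D : OrientedGraph n) where
  open OrientedGraph D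

  Arc : Fin n → Fin n → Set
  Arc u v = A u v ≡ true

  Adj : Fin n → Fin n → Set
  Adj u v = Arc u v ⊎ Arc v u

data Walk {n : ℕ} (R : Fin n → Fin n → Set) : Fin n → Fin n → Set where
  []  : ∀ {u} → Walk R u u
  _∷_ : ∀ {u v w} → R u v → Walk R v w → Walk R u w

verts : ∀ {n} {R : Fin n → Fin n → Set} {u v} → Walk R u v → List (Fin n)
verts {u = u} []      = u ∷ []
verts {u = u} (_ ∷ p) = u ∷ verts p

len : ∀ {n} {R : Fin n → Fin n → Set} {u v} → Walk R u v → ℕ
len []      = zero
len (_ ∷ p) = suc (len p)

IsPath : ∀ {n} {R : Fin n → Fin n → Set} {u v} → Walk R u v → Set
IsPath p = Unique (verts p)

module _ {n : ℕ} (D : OrientedGraph n) where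

  Connected : Set
  Connected = ∀ u v → Walk (Adj D) u v

  HasCycle : Set
  HasCycle = ∃[ u ] ∃[ v ] Σ (Walk (Adj D) u v) λ p →
               IsPath p × (2 ≤ len p) × Adj D v u

  IsOrientedTree : Set
  IsOrientedTree = (1 ≤ n) × Connected × ¬ HasCycle

  IsGeodesic : ∀ {u v} → Walk (Arc D) u v → Set
  IsGeodesic {u} {v} p =
    IsPath p × (∀ (q : Walk (Arc D) u v) → IsPath q → len p ≤ len q)

  InI : Subset n → Fin n → Set
  InI S x =
    (∣ S ∣ ≤ 1 × x ∈ S)
    ⊎ (2 ≤ ∣ S ∣ × ∃[ u ] ∃[ v ] (u ∈ S × v ∈ S ×
         Σ (Walk (Arc D) u v) λ p → IsGeodesic p × x LM.∈ verts p))

  Convex : Subset n → Set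
  Convex S = ∀ x → InI S x ⇔ x ∈ S

  IsHullOf : Subset n → Subset n → Set
  IsHullOf S H = S ⊆ H × Convex H × (∀ T → S ⊆ T → Convex T → H ⊆ T)

  IsHullSet : Subset n → Set
  IsHullSet S = Σ (Subset n) λ H → IsHullOf S H × (∀ v → v ∈ H)

  IsGeodeticSet : Subset n → Set
  IsGeodeticSet S = ∀ v → InI S v

  IsMinHullSet : Subset n → Set
  IsMinHullSet S = IsHullSet S × (∀ T → IsHullSet T → ∣ S ∣ ≤ ∣ T ∣)

  IsMinGeodeticSet : Subset n → Set
  IsMinGeodeticSet S = IsGeodeticSet S × (∀ T → IsGeodeticSet T → ∣ S ∣ ≤ ∣ T ∣)

  IsHullNumber : ℕ → Set
  IsHullNumber k = (Σ (Subset n) λ S → IsHullSet S × ∣ S ∣ ≡ k)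
                   × (∀ T → IsHullSet T → k ≤ ∣ T ∣)

  IsGeodeticNumber : ℕ → Set
  IsGeodeticNumber k = (Σ (Subset n) λ S → IsGeodeticSet S × ∣ S ∣ ≡ k)
                       × (∀ T → IsGeodeticSet T → k ≤ ∣ T ∣)

  IsTransmitter IsReceiver IsTransitive IsExtreme : Fin n → Set
  IsTransmitter v = ∀ u → ¬ Arc D u v
  IsReceiver v = ∀ w → ¬ Arc D v w
  IsTransitive v = (∃[ u ] Arc D u v) × (∃[ w ] Arc D v w)
                   × (∀ u w → Arc D u v → Arc D v w → Arc D u w)
  IsExtreme v = IsTransmitter v ⊎ IsReceiver v ⊎ IsTransitive v

module Submission where

-- In an orientation of a forest no vertex is transitive (an arc
-- u → w next to u → v → w would close a triangle), so the extreme vertices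
-- are exactly the transmitters and receivers.  A transmitter (receiver) can
-- only occur on a directed walk as its first (last) vertex; hence an extreme
-- vertex v lies in I(T) only if v ∈ T, and the complement of {v} is convex.
-- Consequently every geodetic set and every hull set contains Ext(D).
-- Conversely Ext(D) is geodetic: a non-extreme vertex x has an in-arc u → x
-- and an out-arc x → w, and since D has no directed cycle the path u x w
-- extends backwards to a transmitter and forwards to a receiver; in a forest
-- every path is a geodesic.  Every geodetic set is a hull set, so Ext(D) is
-- the least element (for ⊆) of both families, which gives minimality,
-- uniqueness and the values of hn(D) and gn(D) at once.

open import Defs
open import Data.Nat using (ℕ; zero; suc; _≤_; _<_; _+_; z≤n; s≤s)
open import Data.Nat.Properties using (≤-trans; n≤1+n; +-suc; m≤m+n; <⇒≱; ≰⇒>; _≤?_)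
import Data.Bool as Bool
open import Data.Fin using (Fin; zero; suc; _≟_)
open import Data.Fin.Properties using (any?; injective⇒≤)
open import Data.Fin.Subset using (Subset; _∈_; ∣_∣; _⊆_; ⊤; ⁅_⁆; ∁)
open import Data.Fin.Subset.Properties
  using (_∈?_; ∈⊤; ⊆-antisym; p⊆q⇒∣p∣≤∣q∣; p⊂q⇒∣p∣<∣q∣; x∈p⇒∣p-x∣<∣p∣; x∈p∧x≢y⇒x∈p-y;
         x∈⁅x⁆; x∈⁅y⁆⇒x≡y; ∣⁅x⁆∣≡1; x∉p⇒x∈∁p; x∈∁p⇒x∉p; x≢y⇒x∉⁅y⁆)
open import Data.List using (List; []; _∷_; _∷ʳ_; length; lookup)
import Data.List.Relation.Unary.All as All
open import Data.List.Relation.Unary.All using ([]; _∷_)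
open import Data.List.Relation.Unary.All.Properties using (¬Any⇒All¬)
open import Data.List.Relation.Unary.AllPairs using ([]; _∷_)
open import Data.List.Relation.Unary.Any using (here; there)
  renaming (any? to anyₗ?)
open import Data.List.Relation.Unary.Unique.Propositional using (Unique)
open import Data.List.Relation.Unary.Unique.Propositional.Properties using (++⁺; Unique[x∷xs]⇒x∉xs)
open import Data.List.Membership.Propositional using () renaming (_∈_ to _∈ₗ_; _∉_ to _∉ₗ_)
open import Data.List.Membership.Propositional.Properties using (∈-lookup; ∈-++⁺ˡ)
open import Data.List.Relation.Binary.Subset.Propositional using () renaming (_⊆_ to _⊆ₗ_)
open import Data.Product using (Σ; _×_; _,_)
open import Data.Sum using (_⊎_; inj₁; inj₂)
open import Data.Empty using (⊥; ⊥-elim)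
open import Relation.Nullary using (¬_; yes; no)
open import Relation.Binary.Definitions using (Decidable)
open import Relation.Binary.PropositionalEquality using (_≡_; _≢_; refl; sym; trans; cong; subst; subst₂)
open import Function using (id; _∘_)
open import Function.Definitions using (Injective)
open import Function.Bundles using (_⇔_; Equivalence; mk⇔)

lookup-injective : ∀ {A : Set} (xs : List A) → Unique xs → Injective _≡_ _≡_ (lookup xs)
lookup-injective (x ∷ xs) _          {zero}  {zero}  _  = refl
lookup-injective (x ∷ xs) (x∉xs ∷ _) {zero}  {suc j} eq = ⊥-elim (All.lookup x∉xs (∈-lookup j) eq)
lookup-injective (x ∷ xs) (x∉xs ∷ _) {suc i} {zero}  eq = ⊥-elim (All.lookup x∉xs (∈-lookup i) (sym eq))
lookup-injective (x ∷ xs) (_ ∷ uxs)  {suc i} {suc j} eq = cong suc (lookup-injective xs uxs eq)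

unique-length≤ : ∀ {n} (xs : List (Fin n)) → Unique xs → length xs ≤ n
unique-length≤ xs uxs = injective⇒≤ (lookup-injective xs uxs)

module _ {n : ℕ} {R : Fin n → Fin n → Set} where

  target∈ : ∀ {u v} (p : Walk R u v) → v ∈ₗ verts p
  target∈ []      = here refl
  target∈ (_ ∷ p) = there (target∈ p)

  length-verts : ∀ {u v} (p : Walk R u v) → length (verts p) ≡ suc (len p)
  length-verts []      = refl
  length-verts (_ ∷ p) = cong suc (length-verts p)

  path-len< : ∀ {u v} (p : Walk R u v) → IsPath p → len p < n
  path-len< p p-path = subst (_≤ n) (length-verts p) (unique-length≤ (verts p) p-path)

  ∷-path : ∀ {u v w} (e : R u v) (p : Walk R v w) → IsPath p → u ∉ₗ verts p → IsPath (e ∷ p)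
  ∷-path e p p-path u∉p = ¬Any⇒All¬ (verts p) u∉p ∷ p-path

  source∉tail : ∀ {u v w} (e : R u v) (p : Walk R v w) → IsPath (e ∷ p) → u ∉ₗ verts p
  source∉tail e p = Unique[x∷xs]⇒x∉xs

  closed-path-trivial : ∀ {u y} (p : Walk R u u) → IsPath p → y ∈ₗ verts p → y ≡ u
  closed-path-trivial []      _      (here refl) = refl
  closed-path-trivial (e ∷ p) p-path _           = ⊥-elim (source∉tail e p p-path (target∈ p))

  prefix-to : ∀ {u v x} (p : Walk R u v) → IsPath p → x ∈ₗ verts p →
    Σ (Walk R u x) λ pre → IsPath pre × verts pre ⊆ₗ verts p
  prefix-to []      p-path (here refl) = [] , p-path , id
  prefix-to (e ∷ p) p-path (here refl) = [] , [] ∷ [] , λ { (here refl) → here refl }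
  prefix-to (e ∷ p) p-path@(_ ∷ tail-path) (there x∈p) =
    let pre , pre-path , pre⊆p = prefix-to p tail-path x∈p
    in  e ∷ pre , ∷-path e pre pre-path (source∉tail e p p-path ∘ pre⊆p) ,
        λ { (here refl) → here refl ; (there y∈pre) → there (pre⊆p y∈pre) }

  suffix-from : ∀ {u v x} (p : Walk R u v) → IsPath p → x ∈ₗ verts p → Σ (Walk R x v) IsPath
  suffix-from []      p-path       (here refl) = [] , p-path
  suffix-from (e ∷ p) p-path       (here refl) = e ∷ p , p-path
  suffix-from (_ ∷ p) (_ ∷ p-path) (there x∈p) = suffix-from p p-path x∈p

  snoc : ∀ {u v w} → Walk R u v → R v w → Walk R u w
  snoc []       e = e ∷ []
  snoc (e' ∷ p) e = e' ∷ snoc p e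

  len-snoc : ∀ {u v w} (p : Walk R u v) (e : R v w) → len (snoc p e) ≡ suc (len p)
  len-snoc []       e = refl
  len-snoc (e' ∷ p) e = cong suc (len-snoc p e)

  verts-snoc : ∀ {u v w} (p : Walk R u v) (e : R v w) → verts (snoc p e) ≡ verts p ∷ʳ w
  verts-snoc []       e = refl
  verts-snoc (e' ∷ p) e = cong (_ ∷_) (verts-snoc p e)

  snoc-path : ∀ {u v w} (p : Walk R u v) (e : R v w) → IsPath p → w ∉ₗ verts p → IsPath (snoc p e)
  snoc-path p e p-path w∉p = subst Unique (sym (verts-snoc p e))
    (++⁺ p-path ([] ∷ []) λ { (y∈p , here refl) → w∉p y∈p })

  ⊆-snoc : ∀ {u v w} (p : Walk R u v) (e : R v w) → verts p ⊆ₗ verts (snoc p e)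
  ⊆-snoc p e y∈p = subst (_ ∈ₗ_) (sym (verts-snoc p e)) (∈-++⁺ˡ y∈p)

-- The
-- fuel k measures how many more arcs may be added; since paths have fewer
-- than n arcs it never runs out.
module Extension {n : ℕ} {R : Fin n → Fin n → Set} (R? : Decidable R)
  (acyclic : ∀ {a u} (p : Walk R a u) → IsPath p → ¬ R u a) where

  Source Sink : Fin n → Set
  Source a = ∀ u → ¬ R u a
  Sink b   = ∀ w → ¬ R b w

  extend-backward : ∀ k {a b} (p : Walk R a b) → IsPath p → n ≤ k + len p →
    Σ (Fin n) λ s → Source s × Σ (Walk R s b) λ q → IsPath q × verts p ⊆ₗ verts q
  extend-backward zero p p-path bound = ⊥-elim (<⇒≱ (path-len< p p-path) bound)
  extend-backward (suc k) {a} p p-path bound with any? (λ u → R? u a)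
  ... | no no-in = a , (λ u e → no-in (u , e)) , p , p-path , id
  ... | yes (u , e) with anyₗ? (u ≟_) (verts p)
  ...   | yes u∈p = let pre , pre-path , _ = prefix-to p p-path u∈p in ⊥-elim (acyclic pre pre-path e)
  ...   | no u∉p =
    let s , s-source , q , q-path , e∷p⊆q =
          extend-backward k (e ∷ p) (∷-path e p p-path u∉p) (subst (n ≤_) (sym (+-suc k (len p))) bound)
    in  s , s-source , q , q-path , e∷p⊆q ∘ there

  extend-forward : ∀ k {a b} (p : Walk R a b) → IsPath p → n ≤ k + len p →
    Σ (Fin n) λ t → Sink t × Σ (Walk R a t) λ q → IsPath q × verts p ⊆ₗ verts q
  extend-forward zero p p-path bound = ⊥-elim (<⇒≱ (path-len< p p-path) bound)
  extend-forward (suc k) {b = b} p p-path bound with any? (λ w → R? b w)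
  ... | no no-out = b , (λ w e → no-out (w , e)) , p , p-path , id
  ... | yes (w , e) with anyₗ? (w ≟_) (verts p)
  ...   | yes w∈p = let suf , suf-path = suffix-from p p-path w∈p in ⊥-elim (acyclic suf suf-path e)
  ...   | no w∉p =
    let t , t-sink , q , q-path , p∷e⊆q =
          extend-forward k (snoc p e) (snoc-path p e p-path w∉p)
            (subst (λ l → n ≤ k + l) (sym (len-snoc p e)) (subst (n ≤_) (sym (+-suc k (len p))) bound))
    in  t , t-sink , q , q-path , p∷e⊆q ∘ ⊆-snoc p e

  extend-to-source-and-sink : ∀ {a b} (p : Walk R a b) → IsPath p →
    Σ (Fin n) λ s → Σ (Fin n) λ t → Source s × Sink t ×
      Σ (Walk R s t) λ q → IsPath q × verts p ⊆ₗ verts q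
  extend-to-source-and-sink p p-path =
    let s , s-source , q , q-path , p⊆q = extend-backward n p p-path (m≤m+n n (len p))
        t , t-sink , r , r-path , q⊆r = extend-forward n q q-path (m≤m+n n (len q))
    in  s , t , s-source , t-sink , r , r-path , q⊆r ∘ p⊆q

module OrientedGraphFacts {n : ℕ} (D : OrientedGraph n) where
  open OrientedGraph D

  Arc? : Decidable (Arc D)
  Arc? u v = A u v Bool.≟ Bool.true

  arc-irrefl : ∀ {u v} → Arc D u v → u ≢ v
  arc-irrefl {u} e refl with trans (sym e) (irrefl u)
  ... | ()

  arc-asym : ∀ {u v} → Arc D u v → ¬ Arc D v u
  arc-asym {u} {v} e e' with trans (sym e') (asym u v e)
  ... | ()

  -- Two consecutive arcs form a path, since there are no 2-cycles.
  two-arc-path : ∀ {u v w} (e₁ : Arc D u v) (e₂ : Arc D v w) → IsPath {R = Arc D} (e₁ ∷ e₂ ∷ [])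
  two-arc-path e₁ e₂ =
    (arc-irrefl e₁ ∷ (λ { refl → arc-asym e₁ e₂ }) ∷ []) ∷ (arc-irrefl e₂ ∷ []) ∷ [] ∷ []

  transmitter-first : ∀ {a b y} (p : Walk (Arc D) a b) → y ∈ₗ verts p → IsTransmitter D y → y ≡ a
  transmitter-first []      (here refl) _ = refl
  transmitter-first (e ∷ p) (here refl) _ = refl
  transmitter-first {a} (e ∷ p) (there y∈p) y-trans with transmitter-first p y∈p y-trans
  ... | refl = ⊥-elim (y-trans a e)

  receiver-last : ∀ {a b y} (p : Walk (Arc D) a b) → y ∈ₗ verts p → IsReceiver D y → y ≡ b
  receiver-last []                (here refl) _      = refl
  receiver-last (_∷_ {v = v} e p) (here refl) y-recv = ⊥-elim (y-recv v e)
  receiver-last (e ∷ p)           (there y∈p) y-recv = receiver-last p y∈p y-recv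

  OnlyAtEnds : Fin n → Set
  OnlyAtEnds v = ∀ {a b} (p : Walk (Arc D) a b) → v ∈ₗ verts p → v ≡ a ⊎ v ≡ b

  ⊆-interval : ∀ {S x} → x ∈ S → InI D S x
  ⊆-interval {S} {x} x∈S with ∣ S ∣ ≤? 1
  ... | yes small = inj₁ (small , x∈S)
  ... | no large  = inj₂ (≰⇒> large , x , x , x∈S , x∈S , [] , ([] ∷ [] , λ _ _ → z≤n) , here refl)

  interval-mono : ∀ {S T y} → S ⊆ T → InI D S y → InI D T y
  interval-mono S⊆T (inj₁ (_ , y∈S)) = ⊆-interval (S⊆T y∈S)
  interval-mono S⊆T (inj₂ (large , a , b , a∈S , b∈S , geodesic)) =
    inj₂ (≤-trans large (p⊆q⇒∣p∣≤∣q∣ S⊆T) , a , b , S⊆T a∈S , S⊆T b∈S , geodesic)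

  only-at-ends-interval : ∀ {T v} → OnlyAtEnds v → InI D T v → v ∈ T
  only-at-ends-interval _    (inj₁ (_ , v∈T)) = v∈T
  only-at-ends-interval ends (inj₂ (_ , a , b , a∈T , b∈T , p , _ , v∈p)) with ends p v∈p
  ... | inj₁ refl = a∈T
  ... | inj₂ refl = b∈T

  complement-convex : ∀ {v} → OnlyAtEnds v → Convex D (∁ ⁅ v ⁆)
  complement-convex {v} ends y = mk⇔ to ⊆-interval
    where
    to : InI D (∁ ⁅ v ⁆) y → y ∈ ∁ ⁅ v ⁆
    to y∈I = x∉p⇒x∈∁p λ y∈⁅v⁆ → case-v (x∈⁅y⁆⇒x≡y v y∈⁅v⁆) y∈I
      where
      case-v : y ≡ v → InI D (∁ ⁅ v ⁆) y → ⊥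
      case-v refl v∈I = x∈∁p⇒x∉p (only-at-ends-interval ends v∈I) (x∈⁅x⁆ v)

  only-at-ends-in-hull-set : ∀ {S v} → OnlyAtEnds v → IsHullSet D S → v ∈ S
  only-at-ends-in-hull-set {S} {v} ends (H , (S⊆H , _ , H-least) , H-all) with v ∈? S
  ... | yes v∈S = v∈S
  ... | no v∉S  = ⊥-elim (x∈∁p⇒x∉p (H-least (∁ ⁅ v ⁆) S⊆∁v (complement-convex ends) (H-all v)) (x∈⁅x⁆ v))
    where
    S⊆∁v : S ⊆ ∁ ⁅ v ⁆
    S⊆∁v {y} y∈S = x∉p⇒x∈∁p (x≢y⇒x∉⁅y⁆ λ { refl → v∉S y∈S })

  geodetic⇒hull-set : ∀ {S} → IsGeodeticSet D S → IsHullSet D S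
  geodetic⇒hull-set S-geodetic =
    ⊤ , ((λ _ → ∈⊤) , (λ y → mk⇔ (λ _ → ∈⊤) ⊆-interval) ,
         (λ T S⊆T T-convex {y} _ → Equivalence.to (T-convex y) (interval-mono S⊆T (S-geodetic y)))) ,
    λ _ → ∈⊤

nontrivial-walk : ∀ {n} {R : Fin n → Fin n → Set} {u v} → u ≢ v → (p : Walk R u v) → 1 ≤ len p
nontrivial-walk u≢u []      = ⊥-elim (u≢u refl)
nontrivial-walk _   (_ ∷ _) = s≤s z≤n

module Forest {n : ℕ} (D : OrientedGraph n) (acyclic : ¬ HasCycle D) where
  open OrientedGraphFacts D

  adj-irrefl : ∀ {u v} → Adj D u v → u ≢ v
  adj-irrefl (inj₁ e) = arc-irrefl e
  adj-irrefl (inj₂ e) = arc-irrefl e ∘ sym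

  adj-sym : ∀ {u v} → Adj D u v → Adj D v u
  adj-sym (inj₁ e) = inj₂ e
  adj-sym (inj₂ e) = inj₁ e

  undirected : ∀ {u v} → Walk (Arc D) u v → Walk (Adj D) u v
  undirected []      = []
  undirected (e ∷ p) = inj₁ e ∷ undirected p

  verts-undirected : ∀ {u v} (p : Walk (Arc D) u v) → verts (undirected p) ≡ verts p
  verts-undirected []      = refl
  verts-undirected (e ∷ p) = cong (_ ∷_) (verts-undirected p)

  len-undirected : ∀ {u v} (p : Walk (Arc D) u v) → len (undirected p) ≡ len p
  len-undirected []      = refl
  len-undirected (e ∷ p) = cong suc (len-undirected p)

  undirected-path : ∀ {u v} (p : Walk (Arc D) u v) → IsPath p → IsPath (undirected p)
  undirected-path p = subst Unique (sym (verts-undirected p))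

  -- There is no directed cycle: with at least two arcs it would be a cycle of
  -- the underlying graph, and shorter ones are excluded by orientation.
  no-directed-cycle : ∀ {a u} (p : Walk (Arc D) a u) → IsPath p → ¬ Arc D u a
  no-directed-cycle []             _      e = arc-irrefl e refl
  no-directed-cycle (e₁ ∷ [])      _      e = arc-asym e₁ e
  no-directed-cycle p@(_ ∷ _ ∷ _) p-path e =
    acyclic (_ , _ , undirected p , undirected-path p p-path , s≤s (s≤s z≤n) , inj₁ e)

  -- No vertex is transitive: u → v → w together with u → w is a triangle.
  no-transitive : ∀ {v} → ¬ IsTransitive D v
  no-transitive ((u , e₁) , (w , e₂) , transitive) =
    acyclic (u , w , undirected (e₁ ∷ e₂ ∷ []) , undirected-path (e₁ ∷ e₂ ∷ []) (two-arc-path e₁ e₂) ,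
             s≤s (s≤s z≤n) , inj₂ (transitive u w e₁ e₂))

  extreme-only-at-ends : ∀ {v} → IsExtreme D v → OnlyAtEnds v
  extreme-only-at-ends (inj₁ v-transmitter)         p v∈p = inj₁ (transmitter-first p v∈p v-transmitter)
  extreme-only-at-ends (inj₂ (inj₁ v-receiver))     p v∈p = inj₂ (receiver-last p v∈p v-receiver)
  extreme-only-at-ends (inj₂ (inj₂ v-transitive)) _ _   = ⊥-elim (no-transitive v-transitive)

  -- If the
  -- walk q leaves a along a different edge a c, then c is not on the path p
  -- (else p and that edge close a cycle), so c a p is a path to compare with
  -- the rest of q.
  path-shortest : ∀ {a b} (q : Walk (Adj D) a b) (p : Walk (Adj D) a b) → IsPath p → len p ≤ len q
  path-shortest []      []      _      = z≤n
  path-shortest []      (f ∷ p) p-path = ⊥-elim (source∉tail f p p-path (target∈ p))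
  path-shortest (_ ∷ _) []      _      = z≤n
  path-shortest {a} (_∷_ {v = c} e q) (_∷_ {v = d} f p) p-path@(_ ∷ tail-path) with d ≟ c
  ... | yes refl = s≤s (path-shortest q p tail-path)
  ... | no d≢c with anyₗ? (c ≟_) (verts p)
  ...   | yes c∈p =
    let pre , pre-path , pre⊆p = prefix-to p tail-path c∈p
        cycle-path = ∷-path f pre pre-path (source∉tail f p p-path ∘ pre⊆p)
    in  ⊥-elim (acyclic (a , c , f ∷ pre , cycle-path , s≤s (nontrivial-walk d≢c pre) , adj-sym e))
  ...   | no c∉p =
    let c∉ap : c ∉ₗ verts (f ∷ p)
        c∉ap = λ { (here c≡a) → adj-irrefl e (sym c≡a) ; (there c∈p) → c∉p c∈p }
    in  ≤-trans (n≤1+n (len (f ∷ p))) (≤-trans (path-shortest q (adj-sym e ∷ f ∷ p) (∷-path (adj-sym e) (f ∷ p) p-path c∉ap))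
                                   (n≤1+n _))

  path-geodesic : ∀ {a b} (p : Walk (Arc D) a b) → IsPath p → IsGeodesic D p
  path-geodesic p p-path = p-path , λ q _ →
    subst₂ _≤_ (len-undirected p) (len-undirected q)
      (path-shortest (undirected q) (undirected p) (undirected-path p p-path))

  open Extension Arc? no-directed-cycle

  -- A directed path from a transmitter back to itself consists of that
  -- transmitter alone, so it cannot pass through a non-extreme vertex.
  ends-distinct : ∀ {a t x} (r : Walk (Arc D) a t) → IsPath r → x ∈ₗ verts r →
    ¬ IsExtreme D x → IsTransmitter D a → a ≢ t
  ends-distinct r r-path x∈r x-inner a-transmitter refl with closed-path-trivial r r-path x∈r
  ... | refl = x-inner (inj₁ a-transmitter)

  -- A non-extreme vertex x lies on a geodesic from a transmitter to a
  -- different receiver: extend the path u → x → w through an in-arc and an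
  -- out-arc of x at both ends.
  non-extreme-on-geodesic : ∀ {x} → ¬ IsExtreme D x →
    Σ (Fin n) λ a → Σ (Fin n) λ t → IsTransmitter D a × IsReceiver D t × a ≢ t ×
      Σ (Walk (Arc D) a t) λ r → IsGeodesic D r × x ∈ₗ verts r
  non-extreme-on-geodesic {x} x-inner with any? (λ u → Arc? u x) | any? (λ w → Arc? x w)
  ... | no no-in     | _           = ⊥-elim (x-inner (inj₁ λ u e → no-in (u , e)))
  ... | yes _        | no no-out   = ⊥-elim (x-inner (inj₂ (inj₁ λ w e → no-out (w , e))))
  ... | yes (u , e₁) | yes (w , e₂) =
    let a , t , a-transmitter , t-receiver , r , r-path , uxw⊆r =
          extend-to-source-and-sink (e₁ ∷ e₂ ∷ []) (two-arc-path e₁ e₂)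
        x∈r = uxw⊆r (there (here refl))
    in  a , t , a-transmitter , t-receiver , ends-distinct r r-path x∈r x-inner a-transmitter ,
        r , path-geodesic r r-path , x∈r

member⇒size≥1 : ∀ {n} {x : Fin n} {p : Subset n} → x ∈ p → 1 ≤ ∣ p ∣
member⇒size≥1 {x = x} {p} x∈p =
  subst (_≤ ∣ p ∣) (∣⁅x⁆∣≡1 x) (p⊆q⇒∣p∣≤∣q∣ λ y∈⁅x⁆ → subst (_∈ p) (sym (x∈⁅y⁆⇒x≡y x y∈⁅x⁆)) x∈p)

two-members⇒size≥2 : ∀ {n} {x y : Fin n} {p : Subset n} → x ∈ p → y ∈ p → x ≢ y → 2 ≤ ∣ p ∣
two-members⇒size≥2 x∈p y∈p x≢y =
  ≤-trans (s≤s (member⇒size≥1 (x∈p∧x≢y⇒x∈p-y y∈p (x≢y ∘ sym)))) (x∈p⇒∣p-x∣<∣p∣ x∈p)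

⊆-size-antisym : ∀ {n} {p q : Subset n} → p ⊆ q → ∣ q ∣ ≤ ∣ p ∣ → q ≡ p
⊆-size-antisym {p = p} {q} p⊆q ∣q∣≤∣p∣ = ⊆-antisym q⊆p p⊆q
  where
  q⊆p : q ⊆ p
  q⊆p {x} x∈q with x ∈? p
  ... | yes x∈p = x∈p
  ... | no x∉p  = ⊥-elim (<⇒≱ (p⊂q⇒∣p∣<∣q∣ (p⊆q , x , x∈q , x∉p)) ∣q∣≤∣p∣)

module _ {n : ℕ} (P : Subset n → Set) where

  IsMinimum : Subset n → Set
  IsMinimum S = P S × (∀ T → P T → ∣ S ∣ ≤ ∣ T ∣)

  IsMinimumSize : ℕ → Set
  IsMinimumSize k = (Σ (Subset n) λ S → P S × ∣ S ∣ ≡ k) × (∀ T → P T → k ≤ ∣ T ∣)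

  least-member : ∀ {E} → P E → (∀ T → P T → E ⊆ T) →
    IsMinimum E × (∀ S → IsMinimum S → S ≡ E) × IsMinimumSize ∣ E ∣
  least-member {E} E∈P E-least =
    (E∈P , size-least) ,
    (λ S (S∈P , S-minimum) → ⊆-size-antisym (E-least S S∈P) (S-minimum E E∈P)) ,
    ((E , E∈P , refl) , size-least)
    where
    size-least : ∀ T → P T → ∣ E ∣ ≤ ∣ T ∣
    size-least T T∈P = p⊆q⇒∣p∣≤∣q∣ (E-least T T∈P)

module ExtremeVertices {n : ℕ} (D : OrientedGraph n) (acyclic : ¬ HasCycle D)
  (E : Subset n) (E-extreme : ∀ v → v ∈ E ⇔ IsExtreme D v) where
  open OrientedGraphFacts D
  open Forest D acyclic

  extreme : ∀ {v} → v ∈ E → IsExtreme D v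
  extreme {v} = Equivalence.to (E-extreme v)

  in-E : ∀ {v} → IsExtreme D v → v ∈ E
  in-E {v} = Equivalence.from (E-extreme v)

  E-in-geodetic : ∀ T → IsGeodeticSet D T → E ⊆ T
  E-in-geodetic T T-geodetic {v} v∈E =
    only-at-ends-interval (extreme-only-at-ends (extreme v∈E)) (T-geodetic v)

  E-in-hull-set : ∀ T → IsHullSet D T → E ⊆ T
  E-in-hull-set T T-hull v∈E = only-at-ends-in-hull-set (extreme-only-at-ends (extreme v∈E)) T-hull

  E-geodetic : IsGeodeticSet D E
  E-geodetic x with x ∈? E
  ... | yes x∈E = ⊆-interval x∈E
  ... | no x∉E  =
    let a , t , a-transmitter , t-receiver , a≢t , r , r-geodesic , x∈r = non-extreme-on-geodesic (x∉E ∘ in-E)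
        a∈E = in-E (inj₁ a-transmitter)
        t∈E = in-E (inj₂ (inj₁ t-receiver))
    in  inj₂ (two-members⇒size≥2 a∈E t∈E a≢t , a , t , a∈E , t∈E , r , r-geodesic , x∈r)

proposition12 : ∀ {n : ℕ} (D : OrientedGraph n) → IsOrientedTree D →
    ∀ (E : Subset n) → (∀ v → v ∈ E ⇔ IsExtreme D v) →
    IsMinHullSet D E × IsMinGeodeticSet D E
    × (∀ S → IsMinHullSet D S → S ≡ E)
    × (∀ S → IsMinGeodeticSet D S → S ≡ E)
    × IsHullNumber D ∣ E ∣ × IsGeodeticNumber D ∣ E ∣
proposition12 D (_ , _ , acyclic) E E-extreme =
  let hull-minimum , hull-unique , hull-number =
        least-member (IsHullSet D) (geodetic⇒hull-set E-geodetic) E-in-hull-set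
      geodetic-minimum , geodetic-unique , geodetic-number =
        least-member (IsGeodeticSet D) E-geodetic E-in-geodetic
  in  hull-minimum , geodetic-minimum , hull-unique , geodetic-unique , hull-number , geodetic-number
  where
  open OrientedGraphFacts D using (geodetic⇒hull-set)
  open ExtremeVertices D acyclic E E-extreme
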